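{- Let $(M,\mathcal{X})$, $\mathcal{X}=(X_a)_{a\in V(M)}$, be a median decomposition of a graph $G$. Let $F\subseteq E(M)$ be a minimal cut of $M$ separating $V(M)$ into the two sides $W_1,W_2$. For $i=1,2$ let $U_i$ be the set of vertices of $W_i$ incident with an edge of $F$, and let $Y_i=\bigcup_{x\in W_i}X_x$ and $Z_i=\bigcup_{x\in U_i}X_x$. Then $Z_1\cap Z_2$ separates $Y_1$ from $Y_2$ in $G$, i.e. every path in $G$ from a vertex of $Y_1$ to a vertex of $Y_2$ contains a vertex of $Z_1\cap Z_2$.
   Context: All graphs are finite, simple and undirected. For vertices $u,v$ of a connected graph, $I(u,v)$ is the set of vertices on shortest $(u,v)$-paths; a vertex set $S$ is convex if $I(u,v)\subseteq S$ for all $u,v\in S$. A median graph is a connected graph $M$ with $|I(u,v)\cap I(v,w)\cap I(w,u)|=1$ for all vertices $u,v,w$. A median decomposition of $G$ is a pair $(M,\mathcal{X})$ with $M$ a median graph and $\mathcal{X}=(X_a)_{a\in V(M)}$ subsets of $V(G)$ such that (M1) every edge of $G$ has both ends in some $X_a$, and (M2) for every $v\in V(G)$, $X^{ -1}(v)=\{a: v\in X_a\}$ is non-empty and convex in $M$. A minimal cut of a connected graph is an inclusion-minimal edge set whose removal disconnects it (so its removal leaves exactly two components, the sides $W_1,W_2$). -}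

module Defs where

open import Data.Nat using (ℕ; zero; suc; _≤_)
open import Data.Fin using (Fin)
open import Data.Bool using (Bool; true; false; _∧_; not)
open import Data.List using (List; []; _∷_)
open import Data.List.Membership.Propositional using (_∈_)
open import Data.List.Relation.Unary.Unique.Propositional using (Unique)
open import Data.Product using (Σ; ∃; ∃-syntax; _×_; _,_)
open import Relation.Binary.PropositionalEquality using (_≡_; _≢_)
open import Relation.Nullary using (¬_)

record Graph : Set where
  field
    n      : ℕ
    adj    : Fin n → Fin n → Bool
    sym    : ∀ u v → adj u v ≡ adj v u
    irrefl : ∀ u → adj u u ≡ false
open Graph public

data Walk {k : ℕ} (A : Fin k → Fin k → Bool) : Fin k → Fin k → Set where
  stop : ∀ {u} → Walk A u u
  step : ∀ {u w v} → A u w ≡ true → Walk A w v → Walk A u v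

walkLength : ∀ {k} {A : Fin k → Fin k → Bool} {u v} → Walk A u v → ℕ
walkLength stop       = zero
walkLength (step _ p) = suc (walkLength p)

walkVertices : ∀ {k} {A : Fin k → Fin k → Bool} {u v} → Walk A u v → List (Fin k)
walkVertices {u = u} stop       = u ∷ []
walkVertices {u = u} (step _ p) = u ∷ walkVertices p

IsPath : ∀ {k} {A : Fin k → Fin k → Bool} {u v} → Walk A u v → Set
IsPath p = Unique (walkVertices p)

Reachable : ∀ {k} → (Fin k → Fin k → Bool) → Fin k → Fin k → Set
Reachable A u v = Walk A u v

Connected : ∀ {k} → (Fin k → Fin k → Bool) → Set
Connected {k} A = ∀ (u v : Fin k) → Reachable A u v

InInterval : (G : Graph) → Fin (n G) → Fin (n G) → Fin (n G) → Set
InInterval G u v w =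
  Σ (Walk (adj G) u v) λ p →
    (w ∈ walkVertices p) × (∀ (q : Walk (adj G) u v) → walkLength p ≤ walkLength q)

IsConvex : (G : Graph) → (Fin (n G) → Set) → Set
IsConvex G S = ∀ u v w → S u → S v → InInterval G u v w → S w

IsMedianGraph : Graph → Set
IsMedianGraph M =
  Connected (adj M) ×
  (∀ u v w → Σ (Fin (n M)) λ x →
     (InInterval M u v x × InInterval M v w x × InInterval M w u x) ×
     (∀ y → InInterval M u v y → InInterval M v w y → InInterval M w u y → y ≡ x))

IsMedianDecomposition : (G M : Graph) → (Fin (n M) → Fin (n G) → Bool) → Set
IsMedianDecomposition G M X =
  IsMedianGraph M ×
  (∀ u v → adj G u v ≡ true → ∃[ a ] (X a u ≡ true × X a v ≡ true)) ×
  (∀ v → (∃[ a ] X a v ≡ true) × IsConvex M (λ a → X a v ≡ true))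

IsEdgeSet : (M : Graph) → (Fin (n M) → Fin (n M) → Bool) → Set
IsEdgeSet M F = (∀ a b → F a b ≡ F b a) × (∀ a b → F a b ≡ true → adj M a b ≡ true)

removeEdges : (M : Graph) → (Fin (n M) → Fin (n M) → Bool) → Fin (n M) → Fin (n M) → Bool
removeEdges M F a b = adj M a b ∧ not (F a b)

Disconnects : (M : Graph) → (Fin (n M) → Fin (n M) → Bool) → Set
Disconnects M F = ¬ Connected (removeEdges M F)

IsMinimalCut : (M : Graph) → (Fin (n M) → Fin (n M) → Bool) → Set
IsMinimalCut M F =
  IsEdgeSet M F × Disconnects M F ×
  (∀ F' → IsEdgeSet M F' → (∀ a b → F' a b ≡ true → F a b ≡ true) →
     (∃[ a ] ∃[ b ] (F a b ≡ true × F' a b ≡ false)) → ¬ Disconnects M F')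

-- Minimality of F means that restoring any single edge cd of F reconnects M, and since M − F
-- splits into the two sides of r₁ and r₂, every edge of F joins the two sides and every vertex of
-- M lies on one of them. Now let a vertex z of G lie in a bag on each side. The bags containing z
-- form a convex set, so they contain a shortest walk in M between the two bags; that walk has to
-- cross F, and the crossing edge puts z into a bag of U₁ and a bag of U₂. Along a walk of G from
-- Y₁ to Y₂ every edge lies in some bag, and at the first edge whose bag is on the second side the
-- current vertex of the walk is such a z.
module Submission where

open import Defs hiding (sym)
open import Data.Bool using (Bool; true; false; _∧_; _∨_; not)
open import Data.Bool.Properties using (∧-comm; ∧-conicalˡ; ∧-conicalʳ; ∧-zeroʳ; ∨-zeroʳ) renaming (_≟_ to _≟ᵇ_)
open import Data.Empty using (⊥; ⊥-elim)
open import Data.Fin using (Fin; toℕ; fromℕ<; _≟_; zero; suc)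
open import Data.Fin.Properties using (any?; pigeonhole; toℕ<n; toℕ-fromℕ<)
import Data.Fin.Properties as Fin
open import Data.List using (List; []; _∷_; length; lookup)
open import Data.List.Membership.Propositional using (_∈_)
open import Data.List.Membership.Propositional.Properties using (∈-lookup)
import Data.List.Membership.DecPropositional as DecMembership
open import Data.List.Relation.Unary.All using ([]) renaming (lookup to lookupᴬ)
open import Data.List.Relation.Unary.All.Properties using (¬Any⇒All¬)
open import Data.List.Relation.Unary.AllPairs using ([]; _∷_)
open import Data.List.Relation.Unary.Any using (here; there)
open import Data.List.Relation.Unary.Unique.Propositional using (Unique)
open import Data.Nat using (ℕ; zero; suc; _≤_; _<_; _≤?_)
open import Data.Nat.Induction using (<-rec)
open import Data.Nat.Properties using (≮⇒≥; ≰⇒>; suc-injective)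
open import Data.Product using (Σ; ∃₂; ∃-syntax; _×_; _,_; proj₁; proj₂; map₁; map₂)
open import Data.Sum using (_⊎_; inj₁; inj₂)
import Data.Sum as Sum
open import Function using (_∘_)
open import Level using (Level)
open import Relation.Binary.PropositionalEquality using (_≡_; refl; sym; trans; cong; cong₂; subst)
open import Relation.Nullary using (¬_; Dec; yes; no; does)
open import Relation.Nullary.Decidable using (map′; dec-true; _×-dec_)

least-witness : ∀ {ℓ : Level} {P : ℕ → Set ℓ} → (∀ m → Dec (P m)) →
                ∀ {m} → P m → ∃[ k ] (P k × ∀ {j} → P j → k ≤ j)
least-witness {P = P} P? {m} = <-rec (λ m → P m → ∃[ k ] (P k × ∀ {j} → P j → k ≤ j)) least m
  where
  least : ∀ m → (∀ {i} → i < m → P i → ∃[ k ] (P k × ∀ {j} → P j → k ≤ j)) →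
          P m → ∃[ k ] (P k × ∀ {j} → P j → k ≤ j)
  least m smaller pm with any? (λ (i : Fin m) → P? (toℕ i))
  ... | yes (i , pi) = smaller (toℕ<n i) pi
  ... | no none      = m , pm , λ {j} pj → ≮⇒≥ λ j<m →
                         none (fromℕ< j<m , subst P (sym (toℕ-fromℕ< j<m)) pj)

module _ {k : ℕ} where

  unique-lookup-injective : ∀ {xs : List (Fin k)} → Unique xs →
                            ∀ i j → lookup xs i ≡ lookup xs j → i ≡ j
  unique-lookup-injective (_ ∷ _)      zero    zero    _  = refl
  unique-lookup-injective (x∉xs ∷ _)   zero    (suc j) eq = ⊥-elim (lookupᴬ x∉xs (∈-lookup j) eq)
  unique-lookup-injective (x∉xs ∷ _)   (suc i) zero    eq = ⊥-elim (lookupᴬ x∉xs (∈-lookup i) (sym eq))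
  unique-lookup-injective (_ ∷ unique) (suc i) (suc j) eq =
    cong suc (unique-lookup-injective unique i j eq)

  unique-length≤ : ∀ {xs : List (Fin k)} → Unique xs → length xs ≤ k
  unique-length≤ {xs} unique with length xs ≤? k
  ... | yes short = short
  ... | no long with pigeonhole (≰⇒> long) (lookup xs)
  ...   | i , j , i<j , eq = ⊥-elim (Fin.<-irrefl (unique-lookup-injective unique i j eq) i<j)

module _ {k : ℕ} {A : Fin k → Fin k → Bool} where

  open DecMembership (_≟_ {k}) using (_∈?_)

  infixr 5 _◅◅_
  _◅◅_ : ∀ {u w v} → Walk A u w → Walk A w v → Walk A u v
  stop     ◅◅ q = q
  step e p ◅◅ q = step e (p ◅◅ q)

  reverse : (∀ a b → A a b ≡ A b a) → ∀ {u v} → Walk A u v → Walk A v u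
  reverse A-sym stop       = stop
  reverse A-sym (step e p) = reverse A-sym p ◅◅ step (trans (A-sym _ _) e) stop

  start∈walkVertices : ∀ {u v} (p : Walk A u v) → u ∈ walkVertices p
  start∈walkVertices stop       = here refl
  start∈walkVertices (step _ _) = here refl

  length-walkVertices : ∀ {u v} (p : Walk A u v) → length (walkVertices p) ≡ suc (walkLength p)
  length-walkVertices stop       = refl
  length-walkVertices (step _ p) = cong suc (length-walkVertices p)

  path-length< : ∀ {u v} (p : Walk A u v) → IsPath p → walkLength p < k
  path-length< p path = subst (_≤ k) (length-walkVertices p) (unique-length≤ path)

  suffix-from : ∀ {x u v} (p : Walk A u v) → x ∈ walkVertices p →
                Σ (Walk A x v) λ q → IsPath p → IsPath q
  suffix-from stop       (here refl) = stop , λ path → path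
  suffix-from (step e p) (here refl) = step e p , λ path → path
  suffix-from (step _ p) (there x∈p) with suffix-from p x∈p
  ... | q , preserves = q , λ { (_ ∷ path) → preserves path }

  walk⇒path : ∀ {u v} → Walk A u v → Σ (Walk A u v) IsPath
  walk⇒path stop = stop , [] ∷ []
  walk⇒path {u} (step e p) with walk⇒path p
  ... | q , q-path with u ∈? walkVertices q
  ...   | yes u∈q = map₂ (λ preserves → preserves q-path) (suffix-from q u∈q)
  ...   | no  u∉q = step e q , ¬Any⇒All¬ _ u∉q ∷ q-path

module _ {k : ℕ} (A : Fin k → Fin k → Bool) where

  WalkOfLength : ℕ → Fin k → Fin k → Set
  WalkOfLength m u v = Σ (Walk A u v) λ p → walkLength p ≡ m

  walkOfLength? : ∀ m u v → Dec (WalkOfLength m u v)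
  walkOfLength? zero u v = map′ (λ { refl → stop , refl }) (λ { (stop , _) → refl ; (step _ _ , ()) }) (u ≟ v)
  walkOfLength? (suc m) u v =
    map′ (λ { (w , e , p , len) → step e p , cong suc len })
         (λ { (stop , ()) ; (step e p , len) → _ , e , p , suc-injective len })
         (any? λ w → (A u w ≟ᵇ true) ×-dec walkOfLength? m w v)

  reachable? : ∀ u v → Dec (Walk A u v)
  reachable? u v = map′ (λ (_ , p , _) → p) shortened (any? λ (i : Fin k) → walkOfLength? (toℕ i) u v)
    where
    shortened : Walk A u v → ∃[ i ] WalkOfLength (toℕ i) u v
    shortened p with walk⇒path p
    ... | q , q-path = fromℕ< (path-length< q q-path) , q , sym (toℕ-fromℕ< _)

  Shortest : ∀ {u v} → Walk A u v → Set
  Shortest {u} {v} p = ∀ (q : Walk A u v) → walkLength p ≤ walkLength q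

  shortest-walk : ∀ {u v} → Walk A u v → Σ (Walk A u v) Shortest
  shortest-walk {u} {v} p with least-witness (λ m → walkOfLength? m u v) (p , refl)
  ... | _ , (q , refl) , minimal = q , λ r → minimal (r , refl)

private
  kept-edge : ∀ {x y} → x ≡ true → y ≡ false → x ∧ not y ≡ true
  kept-edge refl refl = refl

  restored-edge : ∀ x z → x ∧ not (true ∧ not z) ≡ true → z ≡ true
  restored-edge true true _ = refl

module MinimalCut (M : Graph) (F : Fin (n M) → Fin (n M) → Bool) (cut : IsMinimalCut M F) where

  M∖F : Fin (n M) → Fin (n M) → Bool
  M∖F = removeEdges M F

  infix 4 _⇝_
  _⇝_ : Fin (n M) → Fin (n M) → Set
  a ⇝ b = Walk M∖F a b

  F-sym : ∀ a b → F a b ≡ F b a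
  F-sym = proj₁ (proj₁ cut)

  M∖F-sym : ∀ a b → M∖F a b ≡ M∖F b a
  M∖F-sym a b = cong₂ (λ x y → x ∧ not y) (Graph.sym M a b) (F-sym a b)

  ⇝-sym : ∀ {a b} → a ⇝ b → b ⇝ a
  ⇝-sym = reverse M∖F-sym

  module WithoutEdge (c d : Fin (n M)) where

    isEnd : Fin (n M) → Bool
    isEnd x = does (x ≟ c) ∨ does (x ≟ d)

    F∖cd : Fin (n M) → Fin (n M) → Bool
    F∖cd a b = F a b ∧ not (isEnd a ∧ isEnd b)

    F∖cd⊆F : ∀ a b → F∖cd a b ≡ true → F a b ≡ true
    F∖cd⊆F a b = ∧-conicalˡ _ _

    F∖cd-isEdgeSet : IsEdgeSet M F∖cd
    F∖cd-isEdgeSet = (λ a b → cong₂ (λ x y → x ∧ not y) (F-sym a b) (∧-comm (isEnd a) (isEnd b)))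
                   , (λ a b e → proj₂ (proj₁ cut) a b (F∖cd⊆F a b e))

    F∖cd-cd : F∖cd c d ≡ false
    F∖cd-cd rewrite dec-true (c ≟ c) refl | dec-true (d ≟ d) refl | ∨-zeroʳ (does (d ≟ c)) =
      ∧-zeroʳ (F c d)

    isEnd⇒endpoint : ∀ x → isEnd x ≡ true → x ≡ c ⊎ x ≡ d
    isEnd⇒endpoint x end with x ≟ c | x ≟ d
    isEnd⇒endpoint x end | yes x≡c | _       = inj₁ x≡c
    isEnd⇒endpoint x end | no  _   | yes x≡d = inj₂ x≡d
    isEnd⇒endpoint x ()  | no  _   | no  _

    -- Cutting the walk after its last use of cd.
    walk-without-cd : ∀ {s t} → Walk (removeEdges M F∖cd) s t → s ⇝ t ⊎ (c ⇝ t ⊎ d ⇝ t)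
    walk-without-cd stop = inj₁ stop
    walk-without-cd {s} (step {w = w} e p) with walk-without-cd p
    ... | inj₂ from-cd = inj₂ from-cd
    ... | inj₁ w⇝t with F s w in Fsw
    ...   | false = inj₁ (step (kept-edge (∧-conicalˡ (adj M s w) _ e) Fsw) w⇝t)
    ...   | true
      with isEnd⇒endpoint w (∧-conicalʳ (isEnd s) (isEnd w) (restored-edge (adj M s w) (isEnd s ∧ isEnd w) e))
    ...     | inj₁ refl = inj₂ (inj₁ w⇝t)
    ...     | inj₂ refl = inj₂ (inj₂ w⇝t)

  cut-edge-crosses : ∀ {r s c d} → ¬ r ⇝ s → F c d ≡ true → r ⇝ c → s ⇝ d
  -- Minimality only says that M − (F − cd) is not disconnected; deciding s ⇝ d turns this
  -- double negation into an actual walk.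
  cut-edge-crosses {r} {s} {c} {d} r↛s Fcd r⇝c with reachable? M∖F s d
  ... | yes s⇝d = s⇝d
  ... | no  s↛d = ⊥-elim (proj₂ (proj₂ cut) F∖cd F∖cd-isEdgeSet F∖cd⊆F (c , d , Fcd , F∖cd-cd)
                            λ reconnected → unreachable (walk-without-cd (reconnected r s)))
    where
    open WithoutEdge c d
    unreachable : r ⇝ s ⊎ (c ⇝ s ⊎ d ⇝ s) → ⊥
    unreachable (inj₁ r⇝s)        = r↛s r⇝s
    unreachable (inj₂ (inj₁ c⇝s)) = r↛s (r⇝c ◅◅ c⇝s)
    unreachable (inj₂ (inj₂ d⇝s)) = s↛d (⇝-sym d⇝s)

  module Sides (r₁ r₂ : Fin (n M)) (r₁↛r₂ : ¬ r₁ ⇝ r₂) where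

    Side : Fin (n M) → Set
    Side x = r₁ ⇝ x ⊎ r₂ ⇝ x

    side-step : ∀ {a w} → adj M a w ≡ true → Side a → Side w
    side-step {a} {w} e side with F a w in Faw
    ... | false = Sum.map (_◅◅ step (kept-edge e Faw) stop) (_◅◅ step (kept-edge e Faw) stop) side
    ... | true  = Sum.[ inj₂ ∘ cut-edge-crosses r₁↛r₂ Faw
                      , inj₁ ∘ cut-edge-crosses (r₁↛r₂ ∘ ⇝-sym) Faw ] side

    sides-cover : Connected (adj M) → ∀ x → Side x
    sides-cover connected x = along (connected r₁ x) (inj₁ stop)
      where
      along : ∀ {a} → Walk (adj M) a x → Side a → Side x
      along stop       side = side
      along (step e p) side = along p (side-step e side)

    walk-crosses-cut : ∀ {a b} (p : Walk (adj M) a b) → r₁ ⇝ a → r₂ ⇝ b →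
                       ∃₂ λ c d → c ∈ walkVertices p × d ∈ walkVertices p ×
                                  F c d ≡ true × r₁ ⇝ c × r₂ ⇝ d
    walk-crosses-cut stop r₁⇝a r₂⇝a = ⊥-elim (r₁↛r₂ (r₁⇝a ◅◅ ⇝-sym r₂⇝a))
    walk-crosses-cut {a} (step {w = w} e p) r₁⇝a r₂⇝b with F a w in Faw
    ... | true  = a , w , here refl , there (start∈walkVertices p) , Faw , r₁⇝a
                , cut-edge-crosses r₁↛r₂ Faw r₁⇝a
    ... | false = map₂ (map₂ (λ (c∈ , d∈ , rest) → there c∈ , there d∈ , rest))
                       (walk-crosses-cut p (r₁⇝a ◅◅ step (kept-edge e Faw) stop) r₂⇝b)

module Separation
  (G M : Graph) (X : Fin (n M) → Fin (n G) → Bool)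
  (connected : Connected (adj M))
  (edge-in-bag : ∀ u v → adj G u v ≡ true → ∃[ a ] (X a u ≡ true × X a v ≡ true))
  (bags-convex : ∀ v → IsConvex M (λ a → X a v ≡ true))
  (F : Fin (n M) → Fin (n M) → Bool) (cut : IsMinimalCut M F)
  (r₁ r₂ : Fin (n M)) (r₁↛r₂ : ¬ Reachable (removeEdges M F) r₁ r₂)
  where

  open MinimalCut M F cut
  open Sides r₁ r₂ r₁↛r₂

  Y : Fin (n M) → Fin (n G) → Set
  Y r v = ∃[ x ] (r ⇝ x × X x v ≡ true)

  U : Fin (n M) → Fin (n M) → Set
  U r x = r ⇝ x × ∃[ y ] F x y ≡ true

  Z : Fin (n M) → Fin (n G) → Set
  Z r v = ∃[ x ] (U r x × X x v ≡ true)

  Y₁∩Y₂⊆Z₁∩Z₂ : ∀ {z} → Y r₁ z → Y r₂ z → Z r₁ z × Z r₂ z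
  Y₁∩Y₂⊆Z₁∩Z₂ {z} (a , r₁⇝a , a∋z) (b , r₂⇝b , b∋z)
    with shortest-walk (adj M) (connected a b)
  ... | p , shortest with walk-crosses-cut p r₁⇝a r₂⇝b
  ...   | c , d , c∈p , d∈p , Fcd , r₁⇝c , r₂⇝d =
            (c , (r₁⇝c , d , Fcd) , on-p c∈p) , (d , (r₂⇝d , c , trans (F-sym d c) Fcd) , on-p d∈p)
    where
    on-p : ∀ {x} → x ∈ walkVertices p → X x z ≡ true
    on-p x∈p = bags-convex z a b _ a∋z b∋z (p , x∈p , shortest)

  walk-meets-Z₁∩Z₂ : ∀ {u v} (p : Walk (adj G) u v) → Y r₁ u → Y r₂ v →
                     ∃[ z ] (z ∈ walkVertices p × Z r₁ z × Z r₂ z)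
  walk-meets-Z₁∩Z₂ {u} stop y₁ y₂ = u , here refl , Y₁∩Y₂⊆Z₁∩Z₂ y₁ y₂
  walk-meets-Z₁∩Z₂ {u} (step {w = w} e p) y₁ y₂ with edge-in-bag u w e
  ... | a , a∋u , a∋w with sides-cover connected a
  ...   | inj₁ r₁⇝a = map₂ (map₁ there) (walk-meets-Z₁∩Z₂ p (a , r₁⇝a , a∋w) y₂)
  ...   | inj₂ r₂⇝a = u , here refl , Y₁∩Y₂⊆Z₁∩Z₂ y₁ (a , r₂⇝a , a∋u)

lemma3p4 : (G M : Graph) (X : Fin (n M) → Fin (n G) → Bool) →
    IsMedianDecomposition G M X →
    (F : Fin (n M) → Fin (n M) → Bool) → IsMinimalCut M F →
    (r₁ r₂ : Fin (n M)) → ¬ Reachable (removeEdges M F) r₁ r₂ →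
    let W₁ = λ (x : Fin (n M)) → Reachable (removeEdges M F) r₁ x
        W₂ = λ (x : Fin (n M)) → Reachable (removeEdges M F) r₂ x
        U₁ = λ (x : Fin (n M)) → W₁ x × ∃[ y ] F x y ≡ true
        U₂ = λ (x : Fin (n M)) → W₂ x × ∃[ y ] F x y ≡ true
        Y₁ = λ (v : Fin (n G)) → ∃[ x ] (W₁ x × X x v ≡ true)
        Y₂ = λ (v : Fin (n G)) → ∃[ x ] (W₂ x × X x v ≡ true)
        Z₁ = λ (v : Fin (n G)) → ∃[ x ] (U₁ x × X x v ≡ true)
        Z₂ = λ (v : Fin (n G)) → ∃[ x ] (U₂ x × X x v ≡ true)
    in (u v : Fin (n G)) → Y₁ u → Y₂ v →
       (p : Walk (adj G) u v) → IsPath p →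
       ∃[ z ] (z ∈ walkVertices p × Z₁ z × Z₂ z)
lemma3p4 G M X ((connected , _) , edge-in-bag , bags) F cut r₁ r₂ r₁↛r₂ u v y₁ y₂ p _ =
  walk-meets-Z₁∩Z₂ p y₁ y₂
  where
  open Separation G M X connected edge-in-bag (λ v → proj₂ (bags v)) F cut r₁ r₂ r₁↛r₂
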